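{- Let $\mathcal{I}$ be an instance of 3-SAT with variables $x_1,\dots,x_k$ and clauses $c_1,\dots,c_l$, and let $G=G(\mathcal{I})$ be the graph defined in the context. Let $\sigma$ be an MNS ordering of $G$ whose last vertex is $t$. Then the set of the first $k+1$ vertices of $\sigma$ consists of $s$ together with exactly one of $x_i,\overline{x}_i$ for each $i\in\{1,\dots,k\}$ (i.e., $s$ together with the literal vertices of some truth assignment, not necessarily satisfying).
   Context: Construction of $G(\mathcal{I})$ for a 3-SAT instance $\mathcal{I}$ with variables $x_1,\dots,x_k$ and clauses $c_1,\dots,c_l$ (each clause a disjunction of three literals): the vertex set consists of literal vertices $X=\{x_1,\dots,x_k,\overline{x}_1,\dots,\overline{x}_k\}$, clause vertices $C=\{c_1,\dots,c_l\}$, and three further vertices $s,b,t$. Edges: every pair of distinct literal vertices is adjacent except the pairs $x_i\overline{x}_i$ ($1\le i\le k$); $C$ is an independent set; each clause vertex $c_j$ is adjacent to every literal vertex except the literal vertices corresponding to the literals occurring in clause $c_j$; $b$ is adjacent to all literal vertices; $s$ and $t$ are each adjacent to all literal vertices and all clause vertices; and $bt$ is an edge. There are no other edges. An MNS ordering is an ordering produced by: choose an arbitrary first vertex; at each subsequent step, where the label of an unnumbered vertex $w$ is the set of positions of already numbered neighbours of $w$, number next an unnumbered vertex whose label is maximal under set inclusion among unnumbered vertices (any tie-break allowed). -}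

module Defs where

open import Data.Nat using (ℕ; suc; _+_; _≤_; _<_)
open import Data.Fin using (Fin; toℕ; fromℕ)
open import Data.Bool using (Bool; true; false)
open import Data.Product using (_×_; _,_; ∃-syntax)
open import Data.Vec using (Vec)
open import Data.Vec.Membership.Propositional using (_∈_)
open import Data.Empty using (⊥)
open import Data.Unit using (⊤)
open import Relation.Nullary using (¬_)
open import Relation.Binary.PropositionalEquality using (_≡_; _≢_)
open import Function.Definitions using (Injective)

-- A literal over variables x_1..x_k: (i , true) is x_i, (i , false) is the negation of x_i.
Literal : ℕ → Set
Literal k = Fin k × Bool

record Instance (k l : ℕ) : Set where
  field
    clause : Fin l → Vec (Literal k) 3
open Instance public

data Vertex (k l : ℕ) : Set where
  lit : Fin k → Bool → Vertex k l
  cl  : Fin l → Vertex k l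
  s b t : Vertex k l

Adj : ∀ {k l} → Instance k l → Vertex k l → Vertex k l → Set
Adj I (lit i p) (lit j q) = i ≢ j
Adj I (lit i p) (cl j)    = ¬ ((i , p) ∈ clause I j)
Adj I (cl j)    (lit i p) = ¬ ((i , p) ∈ clause I j)
Adj I (lit _ _) s = ⊤
Adj I s (lit _ _) = ⊤
Adj I (lit _ _) b = ⊤
Adj I b (lit _ _) = ⊤
Adj I (lit _ _) t = ⊤
Adj I t (lit _ _) = ⊤
Adj I (cl _) s = ⊤
Adj I s (cl _) = ⊤
Adj I (cl _) t = ⊤
Adj I t (cl _) = ⊤
Adj I b t = ⊤
Adj I t b = ⊤
Adj I _ _ = ⊥

lastIndex : ℕ → ℕ → ℕ
lastIndex k l = 2 + (k + k) + l

size : ℕ → ℕ → ℕ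
size k l = suc (lastIndex k l)

record IsOrdering {k l : ℕ} (σ : Fin (size k l) → Vertex k l) : Set where
  field
    injective  : Injective _≡_ _≡_ σ
    surjective : ∀ v → ∃[ p ] σ p ≡ v

-- MNS condition: at each step i, the vertex numbered has a label
-- (positions p < i of numbered neighbours) that is not strictly contained in
-- the label of any still-unnumbered vertex (those at positions j ≥ i).
Label⊆ : ∀ {k l} → Instance k l → (Fin (size k l) → Vertex k l) →
         ℕ → Vertex k l → Vertex k l → Set
Label⊆ I σ i v w = ∀ p → toℕ p < i → Adj I (σ p) v → Adj I (σ p) w

record IsMNS {k l : ℕ} (I : Instance k l) (σ : Fin (size k l) → Vertex k l) : Set where
  field
    ordering : IsOrdering σ
    maximal  : ∀ (i j : Fin (size k l)) → toℕ i ≤ toℕ j →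
               Label⊆ I σ (toℕ i) (σ i) (σ j) →
               Label⊆ I σ (toℕ i) (σ j) (σ i)

lastPos : ∀ k l → Fin (size k l)
lastPos k l = fromℕ (lastIndex k l)

InPrefix : ∀ {k l} → (Fin (size k l) → Vertex k l) → ℕ → Vertex k l → Set
InPrefix σ m v = ∃[ p ] (toℕ p < m × σ p ≡ v)

module Submission where

-- Call a vertex early if it is among the first k + 1. Since t comes last and
-- N(s), N(b) ⊆ N(t) ∪ {t}, maximality of labels puts s before b and b before
-- every clause vertex. When b is numbered, every variable already has a
-- numbered literal: an unnumbered literal would have a label containing that
-- of b, yet s sees the literal and not b. So b comes after k + 1 vertices, and
-- the early vertices are s and literals. No variable has two early literals:
-- when the second one is numbered, either s or a literal of a variable with no
-- numbered literal yet is adjacent to everything numbered so far, hence by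
-- maximality so is the second literal, which however misses its complement.
-- Counting then shows that the early vertices hit s and each variable once.

open import Defs
open import Data.Nat using (ℕ; suc; _≤_; _<_; _<?_)
import Data.Nat.Properties as ℕ
open import Data.Fin using (Fin; toℕ; fromℕ<; inject≤; punchOut) renaming (zero to fzero; suc to fsuc)
import Data.Fin.Properties as Fin
open import Data.Bool using (Bool; true; false)
open import Data.Product using (Σ; ∃; ∃-syntax; _,_; proj₁; proj₂; _×_)
open import Data.Sum using (_⊎_; inj₁; inj₂)
open import Data.Unit using (tt)
open import Data.Empty using (⊥-elim)
open import Function using (_∘_)
open import Function.Bundles using (_⇔_; mk⇔)
open import Function.Definitions using (Injective)
open import Function.Properties.Equivalence using () renaming (trans to ⇔-trans)
open import Relation.Binary using (tri<; tri≈; tri>)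
open import Relation.Nullary using (¬_; yes; no; Dec; contradiction)
open import Relation.Binary.PropositionalEquality using (_≡_; refl; sym; trans; cong; subst; _≢_)

Fin-injective⇒surjective : ∀ {n} {f : Fin n → Fin n} → Injective _≡_ _≡_ f →
                           ∀ y → ∃ λ x → f x ≡ y
Fin-injective⇒surjective {suc n} {f} f-inj y with Fin.any? (λ x → f x Fin.≟ y)
... | yes hit = hit
... | no miss = contradiction (Fin.injective⇒≤ g-inj) ℕ.1+n≰n
  where
  y≢f : ∀ x → y ≢ f x
  y≢f x y≡fx = miss (x , sym y≡fx)

  g : Fin (suc n) → Fin n
  g x = punchOut (y≢f x)

  g-inj : Injective _≡_ _≡_ g
  g-inj = f-inj ∘ Fin.punchOut-injective (y≢f _) (y≢f _)

module _ {k l : ℕ} {I : Instance k l} where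

  Adj-s⇒Adj-t : ∀ x → Adj I x s → Adj I x t
  Adj-s⇒Adj-t (lit _ _) _ = tt
  Adj-s⇒Adj-t (cl _)    _ = tt

  Adj-b⇒Adj-t : ∀ x → x ≢ t → Adj I x b → Adj I x t
  Adj-b⇒Adj-t (lit _ _) _   _ = tt
  Adj-b⇒Adj-t t         x≢t _ = contradiction refl x≢t

data SOrLiteral {k l : ℕ} : Vertex k l → Set where
  s-vertex : SOrLiteral s
  literal  : ∀ i r → SOrLiteral (lit i r)

slot : ∀ {k l} {x : Vertex k l} → SOrLiteral x → Fin (suc k)
slot s-vertex      = fzero
slot (literal i _) = fsuc i

slot-fzero : ∀ {k l} {x : Vertex k l} (sx : SOrLiteral x) → slot sx ≡ fzero → x ≡ s
slot-fzero s-vertex _ = refl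

slot-fsuc : ∀ {k l} {x : Vertex k l} {i} (sx : SOrLiteral x) → slot sx ≡ fsuc i →
            ∃[ r ] x ≡ lit i r
slot-fsuc (literal i r) refl = r , refl

module _ {k l : ℕ} {I : Instance k l} {σ : Fin (size k l) → Vertex k l}
         (mns : IsMNS I σ) (σ-last : σ (lastPos k l) ≡ t) where

  open IsMNS mns
  open IsOrdering ordering

  pos : Vertex k l → Fin (size k l)
  pos v = proj₁ (surjective v)

  σ-pos : ∀ v → σ (pos v) ≡ v
  σ-pos v = proj₂ (surjective v)

  pos-σ : ∀ p → pos (σ p) ≡ p
  pos-σ p = injective (σ-pos (σ p))

  pos-injective : ∀ {u v} → pos u ≡ pos v → u ≡ v
  pos-injective {u} {v} eq = trans (sym (σ-pos u)) (trans (cong σ eq) (σ-pos v))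

  infix 4 _≺_
  _≺_ : Vertex k l → Vertex k l → Set
  u ≺ w = toℕ (pos u) < toℕ (pos w)

  _≺?_ : ∀ u w → Dec (u ≺ w)
  u ≺? w = toℕ (pos u) <? toℕ (pos w)

  ≺-connex : ∀ {u w} → u ≢ w → ¬ (w ≺ u) → u ≺ w
  ≺-connex u≢w w⊀u = ℕ.≤∧≢⇒< (ℕ.≮⇒≥ w⊀u) (u≢w ∘ pos-injective ∘ Fin.toℕ-injective)

  label-maximal : ∀ {u w} → ¬ (w ≺ u) →
                  (∀ x → x ≺ u → Adj I x u → Adj I x w) →
                  (∀ x → x ≺ u → Adj I x w → Adj I x u)
  label-maximal {u} {w} w⊀u dom x x≺u x~w =
    subst (λ y → Adj I y u) (σ-pos x)
      (maximal′ (σ-pos u) (σ-pos w) (ℕ.≮⇒≥ w⊀u) dom′ (pos x) x≺u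
        (subst (λ y → Adj I y w) (sym (σ-pos x)) x~w))
    where
    maximal′ : ∀ {i j u w} → σ i ≡ u → σ j ≡ w → toℕ i ≤ toℕ j →
               Label⊆ I σ (toℕ i) u w → Label⊆ I σ (toℕ i) w u
    maximal′ refl refl = maximal _ _

    dom′ : Label⊆ I σ (toℕ (pos u)) u w
    dom′ p p<u = dom (σ p) (subst (λ q → toℕ q < toℕ (pos u)) (sym (pos-σ p)) p<u)

  adjacent-to-all-before : ∀ {u w} → ¬ (w ≺ u) →
                           (∀ x → x ≺ u → Adj I x w) → (∀ x → x ≺ u → Adj I x u)
  adjacent-to-all-before w⊀u all x x≺u =
    label-maximal w⊀u (λ y y≺u _ → all y y≺u) x x≺u (all x x≺u)

  t-last : ∀ {v} → ¬ (t ≺ v)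
  t-last {v} = ℕ.≤⇒≯ v≼t
    where
    v≼t : toℕ (pos v) ≤ toℕ (pos t)
    v≼t rewrite injective (trans (σ-pos t) (sym σ-last)) | Fin.toℕ-fromℕ (lastIndex k l) =
      ℕ.≤-pred (Fin.toℕ<n (pos v))

  ≺⇒≢t : ∀ {x u} → x ≺ u → x ≢ t
  ≺⇒≢t x≺u refl = t-last x≺u

  ¬≺-dominated-by-t : ∀ {u x} → (∀ y → y ≢ t → Adj I y u → Adj I y t) →
                  Adj I x t → ¬ Adj I x u → ¬ (x ≺ u)
  ¬≺-dominated-by-t N⊆ x~t x≁u x≺u =
    x≁u (label-maximal t-last (λ y y≺u → N⊆ y (≺⇒≢t y≺u)) _ x≺u x~t)

  s≺b : s ≺ b
  s≺b = ≺-connex (λ ()) (¬≺-dominated-by-t (λ y _ → Adj-s⇒Adj-t y) tt (λ ()))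

  b≺cl : ∀ j → b ≺ cl j
  b≺cl j = ≺-connex (λ ()) (¬≺-dominated-by-t Adj-b⇒Adj-t tt (λ ()))

  ≺b⇒SOrLiteral : ∀ {x} → x ≺ b → SOrLiteral x
  ≺b⇒SOrLiteral {lit i r} _   = literal i r
  ≺b⇒SOrLiteral {s}       _   = s-vertex
  ≺b⇒SOrLiteral {b}       b≺b = contradiction b≺b (ℕ.<-irrefl refl)
  ≺b⇒SOrLiteral {t}       t≺b = contradiction t≺b t-last
  ≺b⇒SOrLiteral {cl j}    c≺b = contradiction (b≺cl j) (ℕ.<-asym c≺b)

  Touched : Vertex k l → Fin k → Set
  Touched w i = ∃[ r ] lit i r ≺ w

  touched? : ∀ w i → Dec (Touched w i)
  touched? w i with lit i true ≺? w | lit i false ≺? w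
  ... | yes lt | _      = yes (_ , lt)
  ... | no _   | yes lt = yes (_ , lt)
  ... | no ¬t  | no ¬f  = no λ { (true , lt) → ¬t lt ; (false , lt) → ¬f lt }

  untouched⇒adjacent : ∀ {w i x r} → ¬ Touched w i → x ≺ w → SOrLiteral x → Adj I x (lit i r)
  untouched⇒adjacent _  _   s-vertex         = tt
  untouched⇒adjacent ¬T x≺w (literal _ q) refl = ¬T (q , x≺w)

  touched-before-b : ∀ i → Touched b i
  touched-before-b i with touched? b i
  ... | yes T = T
  ... | no ¬T = ⊥-elim (adjacent-to-all-before (λ lt → ¬T (true , lt))
                  (λ x x≺b → untouched⇒adjacent ¬T x≺b (≺b⇒SOrLiteral x≺b)) s s≺b)

  injection-below⇒≤ : ∀ {a w} (f : Fin a → Vertex k l) → Injective _≡_ _≡_ f →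
                      (∀ i → f i ≺ w) → a ≤ toℕ (pos w)
  injection-below⇒≤ {w = w} f f-inj f≺w = Fin.injective⇒≤ g-inj
    where
    g : _ → Fin (toℕ (pos w))
    g i = fromℕ< (f≺w i)

    g-inj : Injective _≡_ _≡_ g
    g-inj {i} {j} eq = f-inj (pos-injective (Fin.toℕ-injective
      (trans (sym (Fin.toℕ-fromℕ< (f≺w i))) (trans (cong toℕ eq) (Fin.toℕ-fromℕ< (f≺w j))))))

  all-touched⇒≤ : ∀ {w} → s ≺ w → (∀ i → Touched w i) → suc k ≤ toℕ (pos w)
  all-touched⇒≤ {w} s≺w T = injection-below⇒≤ rep rep-inj rep≺w
    where
    rep : Fin (suc k) → Vertex k l
    rep fzero    = s
    rep (fsuc i) = lit i (proj₁ (T i))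

    rep≺w : ∀ i → rep i ≺ w
    rep≺w fzero    = s≺w
    rep≺w (fsuc i) = proj₂ (T i)

    rep-inj : Injective _≡_ _≡_ rep
    rep-inj {fzero}  {fzero}  _  = refl
    rep-inj {fsuc i} {fsuc j} eq with eq
    ... | refl = refl

  b-late : suc k ≤ toℕ (pos b)
  b-late = all-touched⇒≤ s≺b touched-before-b

  Early : Vertex k l → Set
  Early v = toℕ (pos v) < suc k

  early⇒≺b : ∀ {x} → Early x → x ≺ b
  early⇒≺b early = ℕ.<-≤-trans early b-late

  -- Before an early vertex y some vertex not yet numbered sees everything
  -- numbered so far: s if it is still free, else an untouched literal, which
  -- exists because fewer than k + 1 vertices precede y.
  universal-at-early : ∀ {y} → Early y → ∃[ w ] ¬ (w ≺ y) × (∀ x → x ≺ y → Adj I x w)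
  universal-at-early {y} early with s ≺? y
  ... | no s⊀y = s , s⊀y , adj-s
    where
    adj-s : ∀ x → x ≺ y → Adj I x s
    adj-s x x≺y with ≺b⇒SOrLiteral (early⇒≺b (ℕ.<-trans x≺y early))
    ... | s-vertex      = contradiction x≺y s⊀y
    ... | literal _ _   = tt
  ... | yes s≺y with Fin.¬∀⟶∃¬ k (Touched y) (touched? y) (ℕ.<⇒≱ early ∘ all-touched⇒≤ s≺y)
  ...   | i , ¬T = lit i true , (λ lt → ¬T (true , lt)) ,
                   λ x x≺y → untouched⇒adjacent ¬T x≺y (≺b⇒SOrLiteral (early⇒≺b (ℕ.<-trans x≺y early)))

  early-literal-unique : ∀ {i r r′} → Early (lit i r′) → ¬ (lit i r ≺ lit i r′)
  early-literal-unique early earlier with universal-at-early early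
  ... | w , w⊀y , all = adjacent-to-all-before w⊀y all _ earlier refl

  early-polarity-unique : ∀ {i r r′} → Early (lit i r) → Early (lit i r′) → r ≡ r′
  early-polarity-unique {i} {r} {r′} e e′ with ℕ.<-cmp (toℕ (pos (lit i r))) (toℕ (pos (lit i r′)))
  ... | tri< lt _ _ = contradiction lt (early-literal-unique e′)
  ... | tri> _ _ gt = contradiction gt (early-literal-unique e)
  ... | tri≈ _ eq _ with pos-injective (Fin.toℕ-injective eq)
  ...   | refl = refl

  slot-injective-early : ∀ {x y} (sx : SOrLiteral x) (sy : SOrLiteral y) → Early x → Early y →
                         slot sx ≡ slot sy → x ≡ y
  slot-injective-early s-vertex      s-vertex      _  _  _    = refl
  slot-injective-early (literal i r) (literal _ _) ex ey refl = cong (lit i) (early-polarity-unique ex ey)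

  prefix : Fin (suc k) → Fin (size k l)
  prefix p = inject≤ p (ℕ.<⇒≤ (ℕ.≤-<-trans b-late (Fin.toℕ<n (pos b))))

  prefix-early : ∀ p → Early (σ (prefix p))
  prefix-early p = subst (_< suc k) (sym (trans (cong toℕ (pos-σ (prefix p))) (Fin.toℕ-inject≤ p _)))
                    (Fin.toℕ<n p)

  prefix-slot : Fin (suc k) → Fin (suc k)
  prefix-slot p = slot (≺b⇒SOrLiteral (early⇒≺b (prefix-early p)))

  prefix-slot-injective : Injective _≡_ _≡_ prefix-slot
  prefix-slot-injective {p} {q} eq =
    Fin.inject≤-injective _ _ p q (injective
      (slot-injective-early (≺b⇒SOrLiteral _) (≺b⇒SOrLiteral _) (prefix-early p) (prefix-early q) eq))

  early-at-slot : ∀ c → ∃[ x ] Σ (SOrLiteral x) λ sx → Early x × slot sx ≡ c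
  early-at-slot c = σ (prefix p) , _ , prefix-early p , proj₂ hit
    where
    hit : ∃ λ p → prefix-slot p ≡ c
    hit = Fin-injective⇒surjective prefix-slot-injective c

    p : Fin (suc k)
    p = proj₁ hit

  early-s : Early s
  early-s = at-fzero (early-at-slot fzero)
    where
    at-fzero : (∃[ x ] Σ (SOrLiteral x) λ sx → Early x × slot sx ≡ fzero) → Early s
    at-fzero (_ , sx , early , eq) = subst Early (slot-fzero sx eq) early

  early-literal : ∀ i → ∃[ r ] Early (lit i r)
  early-literal i = at-fsuc (early-at-slot (fsuc i))
    where
    at-fsuc : (∃[ x ] Σ (SOrLiteral x) λ sx → Early x × slot sx ≡ fsuc i) → ∃[ r ] Early (lit i r)
    at-fsuc (_ , sx , early , eq) with slot-fsuc sx eq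
    ... | r , refl = r , early

  assignment : Fin k → Bool
  assignment i = proj₁ (early-literal i)

  SOrLiteral-early⇒assigned : ∀ {x} → SOrLiteral x → Early x →
                              x ≡ s ⊎ ∃[ i ] x ≡ lit i (assignment i)
  SOrLiteral-early⇒assigned s-vertex      _     = inj₁ refl
  SOrLiteral-early⇒assigned (literal i r) early =
    inj₂ (i , cong (lit i) (early-polarity-unique early (proj₂ (early-literal i))))

  early⇔assigned : ∀ v → Early v ⇔ (v ≡ s ⊎ ∃[ i ] v ≡ lit i (assignment i))
  early⇔assigned v = mk⇔ to from
    where
    to : Early v → v ≡ s ⊎ ∃[ i ] v ≡ lit i (assignment i)
    to early = SOrLiteral-early⇒assigned (≺b⇒SOrLiteral (early⇒≺b early)) early

    from : v ≡ s ⊎ ∃[ i ] v ≡ lit i (assignment i) → Early v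
    from (inj₁ refl)       = early-s
    from (inj₂ (i , refl)) = proj₂ (early-literal i)

  InPrefix⇔Early : ∀ v → InPrefix σ (suc k) v ⇔ Early v
  InPrefix⇔Early v = mk⇔ to from
    where
    to : InPrefix σ (suc k) v → Early v
    to (p , p<k , refl) = subst (λ q → toℕ q < suc k) (sym (pos-σ p)) p<k

    from : Early v → InPrefix σ (suc k) v
    from early = pos v , early , σ-pos v

lemma4 : ∀ {k l} (I : Instance k l) (σ : Fin (size k l) → Vertex k l) →
    IsMNS I σ → σ (lastPos k l) ≡ t →
    Σ (Fin k → Bool) λ a → (∀ (v : Vertex k l) →
    InPrefix σ (suc k) v ⇔ (v ≡ s ⊎ ∃[ i ] v ≡ lit i (a i)))
lemma4 I σ mns σ-last =
  assignment mns σ-last , λ v → ⇔-trans (InPrefix⇔Early mns σ-last v) (early⇔assigned mns σ-last v)
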